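{- Let $\mathcal{T}$ be a Huffman tree for positive weights $w_1,\ldots,w_n$ and let $\ell \ge 0$. Suppose there exists a weight of some depth-$\ell$ node of $\mathcal{T}$ that is also the weight of some non-leaf node of $\mathcal{T}$ (not necessarily of depth $\ell$), and let $w$ be the largest such weight. Let $t$ be a non-leaf node of $\mathcal{T}$ of weight $w$, with children of weights $w'$ and $w''$ where $w' \le w''$. Then every depth-$\ell$ node of $\mathcal{T}$ has weight at least $w'$, every depth-$(\ell+1)$ node of $\mathcal{T}$ has weight at most $w''$, and one of the following holds: (1) $w' < w''$, the depth of $t$ is $\ell$, and exactly one node of depth $\ell+1$ has weight $w''$; (2) $w' < w''$, the depth of $t$ is $\ell - 1$, and exactly one node of depth $\ell$ has weight $w'$; (3) $w' = w'' = w/2$, and for some $m$, exactly $m$ non-leaf nodes of depth $\ell$ have weight $w$ and exactly $2m + \delta$ nodes of depth $\ell + 1$ have weight $w/2$, where $\delta = 1$ if some node of weight $w/2$ has a sibling of smaller weight, and $\delta = 0$ otherwise.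
   Context: Huffman's algorithm starts with $n$ one-node trees (leaves) labelled $w_1,\ldots,w_n$ and repeatedly removes two trees whose root labels are smallest and joins them as the two children of a new root labelled with the sum of their labels, until one tree remains; ties between equal labels may be broken arbitrarily and the order of the two children may be chosen arbitrarily. Every tree obtainable this way is a Huffman tree for $w_1,\ldots,w_n$. The weight of a node is its label (for a leaf, the corresponding $w_i$; for an internal node, the sum of the weights of its two children). The depth of a node is the length of the path from the root to it.
   Formalization: The weights $w_1,\ldots,w_n$ are positive rationals. -}

module Defs where

open import Data.Bool using (Bool; true; false)
open import Data.List using (List; []; _∷_; [_]; _++_; map; length; filter)
open import Data.List.Relation.Unary.All using (All)
open import Data.List.Relation.Binary.Permutation.Propositional using (_↭_)
open import Data.Maybe using (Maybe; just; nothing)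
open import Data.Nat using (ℕ; zero; suc)
open import Data.Sum using (_⊎_)
open import Data.Product using (Σ; _×_; _,_; ∃-syntax)
open import Data.Rational using (ℚ; _+_; _≤_; _<_; 0ℚ)
open import Data.Rational.Properties using (_≟_)
open import Relation.Binary.PropositionalEquality using (_≡_)
open import Relation.Nullary using (Dec; yes; no; _×-dec_)

data Tree : Set where
  leaf : ℚ → Tree
  node : Tree → Tree → Tree

weight : Tree → ℚ
weight (leaf x)   = x
weight (node a b) = weight a + weight b

-- Huffman's algorithm as a relation between a forest (current list of
-- trees) and a final tree: repeatedly pick (via an arbitrary permutation,
-- which realises arbitrary tie-breaking and child order) two trees a, b
-- whose root weights are both ≤ every remaining root weight, join them.
data HuffmanFrom : List Tree → Tree → Set where
  done : ∀ {t} → HuffmanFrom [ t ] t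
  step : ∀ {F a b rest t} →
         F ↭ (a ∷ b ∷ rest) →
         All (λ s → weight a ≤ weight s) rest →
         All (λ s → weight b ≤ weight s) rest →
         HuffmanFrom (node a b ∷ rest) t →
         HuffmanFrom F t

IsHuffmanTree : List ℚ → Tree → Set
IsHuffmanTree ws T = HuffmanFrom (map leaf ws) T

-- Nodes of a tree are addressed by paths from the root
-- (false = left child, true = right child); depth of a node = length of its path.
Path : Set
Path = List Bool

_at_ : Tree → Path → Maybe Tree
t          at []          = just t
leaf _     at (_ ∷ _)     = nothing
node a b   at (false ∷ p) = a at p
node a b   at (true ∷ p)  = b at p

-- The list (with multiplicity, one entry per node) of subtrees rooted at
-- the nodes of depth ℓ.
level : ℕ → Tree → List Tree
level zero     t          = [ t ]
level (suc ℓ)  (leaf _)   = []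
level (suc ℓ)  (node a b) = level ℓ a ++ level ℓ b

data Internal : Tree → Set where
  internal : ∀ a b → Internal (node a b)

internal? : (t : Tree) → Dec (Internal t)
internal? (leaf _)   = no (λ ())
internal? (node a b) = yes (internal a b)

countW : ℕ → Tree → ℚ → ℕ
countW ℓ T x = length (filter (λ s → weight s ≟ x) (level ℓ T))

countInternalW : ℕ → Tree → ℚ → ℕ
countInternalW ℓ T x =
  length (filter (λ s → internal? s ×-dec (weight s ≟ x)) (level ℓ T))

InternalWeight : Tree → ℚ → Set
InternalWeight T x = ∃[ p ] ∃[ a ] ∃[ b ] (T at p ≡ just (node a b) × weight (node a b) ≡ x)

LevelWeight : ℕ → Tree → ℚ → Set
LevelWeight ℓ T x = ∃[ p ] ∃[ s ] (length p ≡ ℓ × T at p ≡ just s × weight s ≡ x)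

HasSmallerSibling : Tree → ℚ → Set
HasSmallerSibling T h = ∃[ p ] ∃[ a ] ∃[ b ] (T at p ≡ just (node a b) ×
  ((weight a ≡ h × weight b < h) ⊎ (weight b ≡ h × weight a < h)))

-- Huffman's algorithm merges pairs of roots in nondecreasing order, so of any two internal nodes
-- both children of one weigh at most both children of the other (the sibling property); with
-- positive weights this makes weight antitone in depth. Comparing with t, every internal node of weight at least w has both children of
-- weight at least w′, and every internal node of weight at most w has both children of weight at
-- most w″. Nodes above depth ℓ weigh at least w and internal nodes at depth ℓ at most w, which gives
-- the two bounds and puts t at depth ℓ or ℓ - 1. When w′ < w″ these comparisons are strict away
-- from t, so t's own child is the only node of weight w″ at depth ℓ + 1 (resp. of weight w′ at
-- depth ℓ). When w′ = w″ = w/2, a depth-ℓ node has two children of weight w/2 if it is internal of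
-- weight w, one if it is lopsided (one child of weight w/2, the other lighter), and none otherwise;
-- the sibling property allows at most one lopsided node, and a lopsided node must lie at depth ℓ.

module Submission where

open import Defs
open import Data.List using (List; length)
open import Data.List.Relation.Unary.All using (All)
open import Data.Maybe using (just)
open import Data.Nat using (ℕ; suc) renaming (_+_ to _+ℕ_; _*_ to _*ℕ_)
open import Data.Product using (_×_; ∃-syntax)
open import Data.Sum using (_⊎_)
open import Data.Rational using (ℚ; 0ℚ; ½; _*_; _≤_; _<_)
open import Relation.Binary.PropositionalEquality using (_≡_)
open import Relation.Nullary using (¬_)

open import Data.Bool using (Bool; true; false; not)
open import Data.Bool.Properties using () renaming (_≟_ to _≟ᵇ_)
open import Data.Empty using (⊥; ⊥-elim)
open import Data.List using ([]; _∷_; [_]; _++_; _∷ʳ_; map; filter; concatMap; take; drop)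
open import Data.List.Membership.Propositional using (_∈_; lose; find)
open import Data.List.Membership.Propositional.Properties using (∈-++⁺ˡ; ∈-++⁺ʳ; ∈-++⁻; ∈-map⁺)
open import Data.List.Properties
  using (++-assoc; ++-identityʳ; map-++; map-∘; length-++; length-take; take++drop≡id; ∷-injectiveʳ;
         concatMap-++; filter-++; filter-none; filter-some; filter-accept; filter-reject; ≡-dec)
import Data.List.Relation.Binary.Permutation.Propositional as ↭
open import Data.List.Relation.Binary.Permutation.Propositional using (_↭_; ↭-trans; ↭⇒↭ₛ)
open import Data.List.Relation.Binary.Permutation.Propositional.Properties using (All-resp-↭; shifts; ++⁺ˡ)
import Data.List.Relation.Binary.Permutation.Setoid.Properties as Permutationₛ
open import Data.List.Relation.Unary.All as All using ([]; _∷_)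
import Data.List.Relation.Unary.All.Properties as Allₚ
open import Data.List.Relation.Unary.AllPairs using (AllPairs; []; _∷_)
import Data.List.Relation.Unary.AllPairs.Properties as AllPairsₚ
open import Data.List.Relation.Unary.Any using (Any; here; there)
open import Data.List.Reverse using (Reverse; reverseView; []; _∶_∶ʳ_)
open import Data.Maybe.Properties using (just-injective)
open import Data.Nat using (zero; z≤n; s≤s)
import Data.Nat as ℕ
import Data.Nat.Properties as ℕ
open import Data.Nat.Tactic.RingSolver using (solve-∀)
open import Data.Product using (_,_; proj₁; proj₂; map₁; uncurry; ∃₂)
open import Data.Sum using (inj₁; inj₂) renaming (swap to ⊎-swap)
open import Data.Rational using (_+_; _⊔_; _⊓_)
open import Data.Rational.Properties
  using (_≟_; _<?_; ≤-refl; ≤-reflexive; ≤-trans; ≤-antisym; <⇒≤; <-irrefl; <-trans; <-≤-trans; ≤-<-trans; <-cmp;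
         ≮⇒≥; ≰⇒>; +-comm; +-identityʳ; +-mono-≤; +-monoʳ-≤; +-monoʳ-<; +-monoˡ-<; +-mono-<-≤; +-mono-≤-<;
         *-identityˡ; *-distribˡ-+; *-distribʳ-+; ⊓-glb; ⊔-lub; p≤p⊔q; p≤q⊔p; p⊓q≤p; p⊓q≤q)
open import Function using (_∘_)
open import Level using (0ℓ)
open import Relation.Binary.Definitions using (Symmetric; tri<; tri≈; tri>)
open import Relation.Binary.PropositionalEquality
  using (_≢_; refl; sym; trans; cong; cong₂; subst; subst₂; resp₂; setoid; module ≡-Reasoning)
open import Relation.Nullary using (Dec; yes; no; does; _×-dec_; _⊎-dec_)
open import Relation.Unary using (Pred; Decidable)

p≤p+q : ∀ p {q} → 0ℚ ≤ q → p ≤ p + q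
p≤p+q p {q} 0≤q = subst (_≤ p + q) (+-identityʳ p) (+-monoʳ-≤ p 0≤q)

p<p+q : ∀ p {q} → 0ℚ < q → p < p + q
p<p+q p {q} 0<q = subst (_< p + q) (+-identityʳ p) (+-monoʳ-< p 0<q)

<⇒≱ : ∀ {p q : ℚ} → p < q → q ≤ p → ⊥
<⇒≱ p<q q≤p = <-irrefl refl (<-≤-trans p<q q≤p)

≤∧≢⇒< : ∀ {p q : ℚ} → p ≤ q → p ≢ q → p < q
≤∧≢⇒< {p} {q} p≤q p≢q with <-cmp p q
... | tri< p<q _ _ = p<q
... | tri≈ _ p≡q _ = ⊥-elim (p≢q p≡q)
... | tri> _ _ q<p = ⊥-elim (<⇒≱ q<p p≤q)

+-cancel-≤ : ∀ {a b c d} → a + b ≤ c + d → d ≤ b → a ≤ c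
+-cancel-≤ a+b≤c+d d≤b = ≮⇒≥ (λ c<a → <⇒≱ (+-mono-<-≤ c<a d≤b) a+b≤c+d)

½*[p+p]≡p : ∀ p → ½ * (p + p) ≡ p
½*[p+p]≡p p = trans (*-distribˡ-+ ½ p p) (trans (sym (*-distribʳ-+ p ½ ½)) (*-identityˡ p))

AllPairs-∈ : ∀ {A : Set} {R : A → A → Set} {xs x y} → Symmetric R →
  AllPairs R xs → x ∈ xs → y ∈ xs → x ≢ y → R x y
AllPairs-∈ sym-R (_ ∷ _)   (here refl) (here refl) x≢y = ⊥-elim (x≢y refl)
AllPairs-∈ sym-R (Rx ∷ _)  (here refl) (there y∈)  _   = All.lookup Rx y∈
AllPairs-∈ sym-R (Rx ∷ _)  (there x∈)  (here refl) _   = sym-R (All.lookup Rx x∈)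
AllPairs-∈ sym-R (_ ∷ Rxs) (there x∈)  (there y∈)  x≢y = AllPairs-∈ sym-R Rxs x∈ y∈ x≢y

module _ {A : Set} {P : Pred A 0ℓ} (P? : Decidable P) where

  count : List A → ℕ
  count xs = length (filter P? xs)

  count-∷ : ∀ x xs → count (x ∷ xs) ≡ count [ x ] +ℕ count xs
  count-∷ x xs with does (P? x)
  ... | true  = refl
  ... | false = refl

  count-++ : ∀ xs ys → count (xs ++ ys) ≡ count xs +ℕ count ys
  count-++ xs ys = trans (cong length (filter-++ P? xs ys)) (length-++ (filter P? xs))

  count-yes : ∀ x → P x → count [ x ] ≡ 1
  count-yes _ px = cong length (filter-accept P? px)

  count-no : ∀ x → ¬ P x → count [ x ] ≡ 0
  count-no _ ¬px = cong length (filter-reject P? ¬px)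

  count-≤1 : ∀ {xs} → AllPairs (λ x y → P x → P y → ⊥) xs → count xs ℕ.≤ 1
  count-≤1 {[]}     []            = z≤n
  count-≤1 {x ∷ xs} (x-excl ∷ xs-excl) with P? x
  ... | yes px = s≤s (ℕ.≤-reflexive (cong length (filter-none P? (All.map (λ excl → excl px) x-excl))))
  ... | no  _  = count-≤1 xs-excl

  count-≥1 : ∀ {x xs} → x ∈ xs → P x → 1 ℕ.≤ count xs
  count-≥1 x∈ px = filter-some P? (lose x∈ px)

  count-≥1⁻ : ∀ {xs} → 1 ℕ.≤ count xs → Any P xs
  count-≥1⁻ {x ∷ xs} pos with P? x
  ... | yes px = here px
  ... | no  _  = there (count-≥1⁻ pos)

module _ {A B : Set} {P : Pred B 0ℓ} {Q R : Pred A 0ℓ} (P? : Decidable P) (Q? : Decidable Q) (R? : Decidable R)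
         (f : A → List B) (m : ℕ) where

  count-concatMap : ∀ {xs} → All (λ x → count P? (f x) ≡ m *ℕ count Q? [ x ] +ℕ count R? [ x ]) xs →
    count P? (concatMap f xs) ≡ m *ℕ count Q? xs +ℕ count R? xs
  count-concatMap {[]}     []           = sym (trans (ℕ.+-identityʳ (m *ℕ 0)) (ℕ.*-zeroʳ m))
  count-concatMap {x ∷ xs} (fx ∷ f-xs) = begin
    count P? (f x ++ concatMap f xs)                   ≡⟨ count-++ P? (f x) (concatMap f xs) ⟩
    count P? (f x) +ℕ count P? (concatMap f xs)         ≡⟨ cong₂ _+ℕ_ fx (count-concatMap f-xs) ⟩
    (m *ℕ count Q? [ x ] +ℕ count R? [ x ]) +ℕ (m *ℕ count Q? xs +ℕ count R? xs)
      ≡⟨ regroup m (count Q? [ x ]) (count R? [ x ]) (count Q? xs) (count R? xs) ⟩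
    m *ℕ (count Q? [ x ] +ℕ count Q? xs) +ℕ (count R? [ x ] +ℕ count R? xs)
      ≡⟨ sym (cong₂ (λ q r → m *ℕ q +ℕ r) (count-∷ Q? x xs) (count-∷ R? x xs)) ⟩
    m *ℕ count Q? (x ∷ xs) +ℕ count R? (x ∷ xs) ∎
    where
    open ≡-Reasoning
    regroup : ∀ m a b c d → (m *ℕ a +ℕ b) +ℕ (m *ℕ c +ℕ d) ≡ m *ℕ (a +ℕ c) +ℕ (b +ℕ d)
    regroup = solve-∀

≤1-cases : ∀ {A : Set} {n} → n ℕ.≤ 1 → (A → 1 ℕ.≤ n) → (1 ℕ.≤ n → A) → (A × n ≡ 1) ⊎ (¬ A × n ≡ 0)
≤1-cases {n = zero}        _         A⇒ _  = inj₂ ((λ a → ℕ.n≮0 (A⇒ a)) , refl)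
≤1-cases {n = suc zero}    _         _  ⇒A = inj₁ (⇒A (s≤s z≤n) , refl)
≤1-cases {n = suc (suc n)} (s≤s ()) _  _

≡⊎≡not : ∀ x y → x ≡ y ⊎ x ≡ not y
≡⊎≡not false false = inj₁ refl
≡⊎≡not false true  = inj₂ refl
≡⊎≡not true  false = inj₂ refl
≡⊎≡not true  true  = inj₁ refl

child : Bool → Tree → Tree → Tree
child false a b = a
child true  a b = b

weight-node : ∀ x a b → weight (node a b) ≡ weight (child x a b) + weight (child (not x) a b)
weight-node false a b = refl
weight-node true  a b = +-comm (weight a) (weight b)

Positive : Tree → Set
Positive (leaf x)   = 0ℚ < x
Positive (node a b) = Positive a × Positive b

weight-pos : ∀ {t} → Positive t → 0ℚ < weight t
weight-pos {leaf x}   0<x        = 0<x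
weight-pos {node a b} (pa , pb) = <-trans (weight-pos pa) (p<p+q (weight a) (weight-pos pb))

child-pos : ∀ x {a b} → Positive (node a b) → Positive (child x a b)
child-pos false (pa , pb) = pa
child-pos true  (pa , pb) = pb

child<node : ∀ x {a b} → Positive (node a b) → weight (child x a b) < weight (node a b)
child<node x {a} {b} pab =
  subst (weight (child x a b) <_) (sym (weight-node x a b)) (p<p+q _ (weight-pos (child-pos (not x) pab)))

_≟ₚ_ : (p q : Path) → Dec (p ≡ q)
_≟ₚ_ = ≡-dec _≟ᵇ_

at-child : ∀ x a b → node a b at [ x ] ≡ just (child x a b)
at-child false a b = refl
at-child true  a b = refl

at-++ : ∀ t g r {u} → t at g ≡ just u → t at (g ++ r) ≡ u at r
at-++ t          []          r refl = refl
at-++ (node a b) (false ∷ g) r e    = at-++ a g r e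
at-++ (node a b) (true ∷ g)  r e    = at-++ b g r e

at-++⁻ : ∀ t g r {v} → t at (g ++ r) ≡ just v → ∃[ u ] (t at g ≡ just u × u at r ≡ just v)
at-++⁻ t          []          r e = t , refl , e
at-++⁻ (node a b) (false ∷ g) r e = at-++⁻ a g r e
at-++⁻ (node a b) (true ∷ g)  r e = at-++⁻ b g r e

at-∷ʳ : ∀ t g x {a b} → t at g ≡ just (node a b) → t at (g ∷ʳ x) ≡ just (child x a b)
at-∷ʳ t g x {a} {b} e = trans (at-++ t g [ x ] e) (at-child x a b)

at-∷ʳ⁻ : ∀ t g x {v} → t at (g ∷ʳ x) ≡ just v → ∃₂ λ a b → t at g ≡ just (node a b) × child x a b ≡ v
at-∷ʳ⁻ t g x e with at-++⁻ t g [ x ] e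
at-∷ʳ⁻ t g false e | node a b , e₁ , e₂ = a , b , e₁ , just-injective e₂
at-∷ʳ⁻ t g true  e | node a b , e₁ , e₂ = a , b , e₁ , just-injective e₂

at-functional : ∀ t g {u v} → t at g ≡ just u → t at g ≡ just v → u ≡ v
at-functional t g e₁ e₂ = just-injective (trans (sym e₁) e₂)

Positive-at : ∀ t g {s} → Positive t → t at g ≡ just s → Positive s
Positive-at t          []          pt refl = pt
Positive-at (node a b) (false ∷ g) pt e    = Positive-at a g (proj₁ pt) e
Positive-at (node a b) (true ∷ g)  pt e    = Positive-at b g (proj₂ pt) e

weight-at-≤ : ∀ t g {s} → Positive t → t at g ≡ just s → weight s ≤ weight t
weight-at-≤ t          []          pt refl = ≤-refl
weight-at-≤ (node a b) (false ∷ g) pt e    =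
  ≤-trans (weight-at-≤ a g (proj₁ pt) e) (<⇒≤ (child<node false pt))
weight-at-≤ (node a b) (true ∷ g)  pt e    =
  ≤-trans (weight-at-≤ b g (proj₂ pt) e) (<⇒≤ (child<node true pt))

ancestor-≥ : ∀ t q k {v} → Positive t → k ℕ.≤ length q → t at q ≡ just v →
  ∃₂ λ g u → length g ≡ k × t at g ≡ just u × weight v ≤ weight u
ancestor-≥ t q k {v} pt k≤q e
  with at-++⁻ t (take k q) (drop k q) (subst (λ r → t at r ≡ just v) (sym (take++drop≡id k q)) e)
... | u , e₁ , e₂ =
  take k q , u , trans (length-take k q) (ℕ.m≤n⇒m⊓n≡m k≤q) , e₁ ,
  weight-at-≤ u (drop k q) (Positive-at t (take k q) pt e₁) e₂

length-∷ʳ : ∀ (g : Path) x → length (g ∷ʳ x) ≡ suc (length g)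
length-∷ʳ g x = trans (length-++ g) (ℕ.+-comm (length g) 1)

∷ʳ-<⁻ : ∀ (g₁ g₂ : Path) {x₁ x₂} → length (g₁ ∷ʳ x₁) ℕ.< length (g₂ ∷ʳ x₂) → length g₁ ℕ.< length g₂
∷ʳ-<⁻ g₁ g₂ {x₁} {x₂} lt = ℕ.≤-pred (subst₂ ℕ._<_ (length-∷ʳ g₁ x₁) (length-∷ʳ g₂ x₂) lt)

length-<⇒≢ : ∀ {p q : Path} → length p ℕ.< length q → p ≢ q
length-<⇒≢ lt refl = ℕ.<-irrefl refl lt

∷ʳ-view : ∀ (q : Path) {k} → length q ≡ suc k → ∃₂ λ g x → q ≡ g ∷ʳ x × length g ≡ k
∷ʳ-view q e with reverseView q
... | g ∶ _ ∶ʳ x = g , x , refl , ℕ.suc-injective (trans (sym (length-∷ʳ g x)) e)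

∈-level⁻ : ∀ k t {s} → s ∈ level k t → ∃[ q ] (length q ≡ k × t at q ≡ just s)
∈-level⁻ zero    t          (here refl) = [] , refl , refl
∈-level⁻ (suc k) (node a b) s∈ with ∈-++⁻ (level k a) s∈
... | inj₁ s∈a = let q , l , e = ∈-level⁻ k a s∈a in false ∷ q , cong suc l , e
... | inj₂ s∈b = let q , l , e = ∈-level⁻ k b s∈b in true ∷ q , cong suc l , e

∈-level⁺ : ∀ k t q {s} → length q ≡ k → t at q ≡ just s → s ∈ level k t
∈-level⁺ zero    t          []          refl refl = here refl
∈-level⁺ (suc k) (node a b) (false ∷ q) l    e    = ∈-++⁺ˡ (∈-level⁺ k a q (ℕ.suc-injective l) e)
∈-level⁺ (suc k) (node a b) (true ∷ q)  l    e    = ∈-++⁺ʳ (level k a) (∈-level⁺ k b q (ℕ.suc-injective l) e)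

level-allPairs : ∀ {R : Tree → Tree → Set} k t →
  (∀ q₁ q₂ {s₁ s₂} → q₁ ≢ q₂ → length q₁ ≡ k → length q₂ ≡ k →
    t at q₁ ≡ just s₁ → t at q₂ ≡ just s₂ → R s₁ s₂) →
  AllPairs R (level k t)
level-allPairs zero    t          _    = [] ∷ []
level-allPairs (suc k) (leaf _)   _    = []
level-allPairs (suc k) (node a b) R-at = AllPairsₚ.++⁺
  (level-allPairs k a λ q₁ q₂ q₁≢q₂ l₁ l₂ →
    R-at (false ∷ q₁) (false ∷ q₂) (q₁≢q₂ ∘ ∷-injectiveʳ) (cong suc l₁) (cong suc l₂))
  (level-allPairs k b λ q₁ q₂ q₁≢q₂ l₁ l₂ →
    R-at (true ∷ q₁) (true ∷ q₂) (q₁≢q₂ ∘ ∷-injectiveʳ) (cong suc l₁) (cong suc l₂))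
  (All.tabulate λ s₁∈ → All.tabulate λ s₂∈ →
    let q₁ , l₁ , e₁ = ∈-level⁻ k a s₁∈
        q₂ , l₂ , e₂ = ∈-level⁻ k b s₂∈
    in R-at (false ∷ q₁) (true ∷ q₂) (λ ()) (cong suc l₁) (cong suc l₂) e₁ e₂)

level-All : ∀ {P : Tree → Set} k t → (∀ q {s} → length q ≡ k → t at q ≡ just s → P s) → All P (level k t)
level-All k t P-at = All.tabulate λ s∈ → let q , l , e = ∈-level⁻ k t s∈ in P-at q l e

children : Tree → List Tree
children (leaf _)   = []
children (node a b) = a ∷ b ∷ []

level-suc : ∀ k t → level (suc k) t ≡ concatMap children (level k t)
level-suc zero    (leaf _)   = refl
level-suc zero    (node a b) = refl
level-suc (suc k) (leaf _)   = refl
level-suc (suc k) (node a b) =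
  trans (cong₂ _++_ (level-suc k a) (level-suc k b)) (sym (concatMap-++ children (level k a) (level k b)))

level-count≡1 : ∀ {P : Pred Tree 0ℓ} (P? : Decidable P) k t q₀ {s₀} →
  length q₀ ≡ k → t at q₀ ≡ just s₀ → P s₀ →
  (∀ q {s} → length q ≡ k → t at q ≡ just s → P s → q ≡ q₀) → count P? (level k t) ≡ 1
level-count≡1 P? k t q₀ l₀ e₀ P₀ only-q₀ = ℕ.≤-antisym
  (count-≤1 P? (level-allPairs k t λ q₁ q₂ q₁≢q₂ l₁ l₂ e₁ e₂ P₁ P₂ →
    q₁≢q₂ (trans (only-q₀ q₁ l₁ e₁ P₁) (sym (only-q₀ q₂ l₂ e₂ P₂)))))
  (count-≥1 P? (∈-level⁺ k t q₀ l₀ e₀) P₀)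

top bottom : ℚ × ℚ → ℚ
top    = uncurry _⊔_
bottom = uncurry _⊓_

record _≼_ (p q : ℚ × ℚ) : Set where
  constructor ≼-intro
  field top≤bottom : top p ≤ bottom q

_≶_ : ℚ × ℚ → ℚ × ℚ → Set
p ≶ q = p ≼ q ⊎ q ≼ p

≶-sym : Symmetric _≶_
≶-sym = ⊎-swap

child≤⊔ : ∀ x a b → weight (child x a b) ≤ top (weight a , weight b)
child≤⊔ false a b = p≤p⊔q (weight a) (weight b)
child≤⊔ true  a b = p≤q⊔p (weight a) (weight b)

⊓≤child : ∀ x a b → bottom (weight a , weight b) ≤ weight (child x a b)
⊓≤child false a b = p⊓q≤p (weight a) (weight b)
⊓≤child true  a b = p⊓q≤q (weight a) (weight b)

≼-child : ∀ {a b c d} → (weight a , weight b) ≼ (weight c , weight d) →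
  ∀ x y → weight (child x a b) ≤ weight (child y c d)
≼-child {a} {b} {c} {d} (≼-intro top≤bottom) x y =
  ≤-trans (child≤⊔ x a b) (≤-trans top≤bottom (⊓≤child y c d))

childPairs : Tree → List (ℚ × ℚ)
childPairs (leaf _)   = []
childPairs (node a b) = (weight a , weight b) ∷ childPairs a ++ childPairs b

forestPairs : List Tree → List (ℚ × ℚ)
forestPairs = concatMap childPairs

forestPairs-↭ : ∀ {F G} → F ↭ G → forestPairs F ↭ forestPairs G
forestPairs-↭ ↭.refl         = ↭.refl
forestPairs-↭ (↭.prep t π)   = ++⁺ˡ (childPairs t) (forestPairs-↭ π)
forestPairs-↭ (↭.swap s t π) =
  ↭-trans (shifts (childPairs s) (childPairs t)) (++⁺ˡ (childPairs t) (++⁺ˡ (childPairs s) (forestPairs-↭ π)))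
forestPairs-↭ (↭.trans π ρ)  = ↭-trans (forestPairs-↭ π) (forestPairs-↭ ρ)

forestPairs-join : ∀ a b rest →
  forestPairs (node a b ∷ rest) ≡ (weight a , weight b) ∷ forestPairs (a ∷ b ∷ rest)
forestPairs-join a b rest = cong (_ ∷_) (++-assoc (childPairs a) (childPairs b) (forestPairs rest))

record Ordered (F : List Tree) : Set where
  field
    positive   : All Positive F
    comparable : AllPairs _≶_ (forestPairs F)
    belowRoots : All (λ q → All (λ f → top q ≤ weight f) F) (forestPairs F)

ordered-↭ : ∀ {F G} → F ↭ G → Ordered F → Ordered G
ordered-↭ π o = record
  { positive   = All-resp-↭ π positive
  ; comparable = Permutationₛ.AllPairs-resp-↭ (setoid _) ≶-sym (resp₂ _≶_) (↭⇒↭ₛ (forestPairs-↭ π)) comparable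
  ; belowRoots = All-resp-↭ (forestPairs-↭ π) (All.map (All-resp-↭ π) belowRoots)
  }
  where open Ordered o

-- Every earlier pair lies below the roots a and b, hence below the new pair (a , b).
ordered-join : ∀ {a b rest} →
  All (λ s → weight a ≤ weight s) rest → All (λ s → weight b ≤ weight s) rest →
  Ordered (a ∷ b ∷ rest) → Ordered (node a b ∷ rest)
ordered-join {a} {b} {rest} a≤rest b≤rest o with Ordered.positive o
... | pa ∷ pb ∷ prest = record
  { positive   = (pa , pb) ∷ prest
  ; comparable = subst (AllPairs _≶_) (sym (forestPairs-join a b rest))
      (All.map (λ { (q≤a ∷ q≤b ∷ _) → inj₂ (≼-intro (⊓-glb q≤a q≤b)) }) belowRoots ∷ comparable)
  ; belowRoots = subst (All (λ q → All (λ f → top q ≤ weight f) (node a b ∷ rest)))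
      (sym (forestPairs-join a b rest))
      ((⊔-lub a≤a+b b≤a+b ∷ All.zipWith (uncurry ⊔-lub) (a≤rest , b≤rest))
       ∷ All.map (λ { (q≤a ∷ _ ∷ q≤rest) → ≤-trans q≤a a≤a+b ∷ q≤rest }) belowRoots)
  }
  where
  open Ordered o
  a≤a+b : weight a ≤ weight a + weight b
  a≤a+b = p≤p+q (weight a) (<⇒≤ (weight-pos pb))
  b≤a+b : weight b ≤ weight a + weight b
  b≤a+b = subst (weight b ≤_) (+-comm (weight b) (weight a)) (p≤p+q (weight b) (<⇒≤ (weight-pos pa)))

ordered-huffman : ∀ {F T} → HuffmanFrom F T → Ordered F → Ordered [ T ]
ordered-huffman done                  o = o
ordered-huffman (step π a≤rest b≤rest H) o = ordered-huffman H (ordered-join a≤rest b≤rest (ordered-↭ π o))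

ordered-leaves : ∀ {ws} → All (0ℚ <_) ws → Ordered (map leaf ws)
ordered-leaves {ws} pos = record
  { positive   = Allₚ.map⁺ pos
  ; comparable = subst (AllPairs _≶_) (sym (forestPairs-leaves ws)) []
  ; belowRoots = subst (All _) (sym (forestPairs-leaves ws)) []
  }
  where
  forestPairs-leaves : ∀ ws → forestPairs (map leaf ws) ≡ []
  forestPairs-leaves []       = refl
  forestPairs-leaves (_ ∷ ws) = forestPairs-leaves ws

branchings : Tree → List (Path × (ℚ × ℚ))
branchings (leaf _)   = []
branchings (node a b) =
  ([] , (weight a , weight b)) ∷ map (map₁ (false ∷_)) (branchings a) ++ map (map₁ (true ∷_)) (branchings b)

branchings-pairs : ∀ t → map proj₂ (branchings t) ≡ childPairs t
branchings-pairs (leaf _)   = refl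
branchings-pairs (node a b) = cong ((weight a , weight b) ∷_) (begin
  map proj₂ (map (map₁ (false ∷_)) (branchings a) ++ map (map₁ (true ∷_)) (branchings b))
    ≡⟨ map-++ proj₂ (map (map₁ (false ∷_)) (branchings a)) _ ⟩
  map proj₂ (map (map₁ (false ∷_)) (branchings a)) ++ map proj₂ (map (map₁ (true ∷_)) (branchings b))
    ≡⟨ cong₂ _++_ (sym (map-∘ (branchings a))) (sym (map-∘ (branchings b))) ⟩
  map proj₂ (branchings a) ++ map proj₂ (branchings b)
    ≡⟨ cong₂ _++_ (branchings-pairs a) (branchings-pairs b) ⟩
  childPairs a ++ childPairs b ∎)
  where open ≡-Reasoning

∈-branchings : ∀ t g {a b} → t at g ≡ just (node a b) → (g , (weight a , weight b)) ∈ branchings t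
∈-branchings t          []          refl = here refl
∈-branchings (node a b) (false ∷ g) e    =
  there (∈-++⁺ˡ (∈-map⁺ (map₁ (false ∷_)) (∈-branchings a g e)))
∈-branchings (node a b) (true ∷ g)  e    =
  there (∈-++⁺ʳ _ (∈-map⁺ (map₁ (true ∷_)) (∈-branchings b g e)))

SiblingProperty : Tree → Set
SiblingProperty t = ∀ g₁ g₂ {a₁ b₁ a₂ b₂} → g₁ ≢ g₂ →
  t at g₁ ≡ just (node a₁ b₁) → t at g₂ ≡ just (node a₂ b₂) →
  (weight a₁ , weight b₁) ≶ (weight a₂ , weight b₂)

comparable⇒sibling : ∀ {t} → AllPairs _≶_ (childPairs t) → SiblingProperty t
comparable⇒sibling {t} cmp g₁ g₂ g₁≢g₂ e₁ e₂ =
  AllPairs-∈ ≶-sym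
    (AllPairsₚ.map⁻ (subst (AllPairs _≶_) (sym (branchings-pairs t)) cmp))
    (∈-branchings t g₁ e₁) (∈-branchings t g₂ e₂) (λ eq → g₁≢g₂ (cong proj₁ eq))

huffman-sibling : ∀ {ws T} → All (0ℚ <_) ws → IsHuffmanTree ws T → Positive T × SiblingProperty T
huffman-sibling {T = T} pos H with ordered-huffman H (ordered-leaves pos)
... | record { positive = pT ∷ [] ; comparable = cmp } =
  pT , comparable⇒sibling (subst (AllPairs _≶_) (++-identityʳ (childPairs T)) cmp)

depth-antitone : ∀ {T} → Positive T → SiblingProperty T → ∀ q₁ q₂ {u v} → length q₁ ℕ.< length q₂ →
  T at q₁ ≡ just u → T at q₂ ≡ just v → weight v ≤ weight u
depth-antitone {T} pos sib q₁ q₂ = go (reverseView q₁) (reverseView q₂)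
  where
  go : ∀ {q₁ q₂ u v} → Reverse q₁ → Reverse q₂ → length q₁ ℕ.< length q₂ →
    T at q₁ ≡ just u → T at q₂ ≡ just v → weight v ≤ weight u
  go {q₂ = q₂} [] _ _ refl e₂ = weight-at-≤ T q₂ pos e₂
  go (g₁ ∶ _ ∶ʳ x₁) [] lt = ⊥-elim (ℕ.n≮0 lt)
  go (g₁ ∶ r₁ ∶ʳ x₁) (g₂ ∶ r₂ ∶ʳ x₂) lt e₁ e₂
    with at-∷ʳ⁻ T g₁ x₁ e₁ | at-∷ʳ⁻ T g₂ x₂ e₂
  ... | a₁ , b₁ , at₁ , refl | a₂ , b₂ , at₂ , refl
    with sib g₁ g₂ (length-<⇒≢ (∷ʳ-<⁻ g₁ g₂ lt)) at₁ at₂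
  ... | inj₂ g₂≼g₁ = ≼-child g₂≼g₁ x₂ x₁
  ... | inj₁ g₁≼g₂ = +-cancel-≤ parents (≼-child g₁≼g₂ (not x₁) (not x₂))
    where
    parents : weight (child x₂ a₂ b₂) + weight (child (not x₂) a₂ b₂)
            ≤ weight (child x₁ a₁ b₁) + weight (child (not x₁) a₁ b₁)
    parents = subst₂ _≤_ (weight-node x₂ a₂ b₂) (weight-node x₁ a₁ b₁) (go r₁ r₂ (∷ʳ-<⁻ g₁ g₂ lt) at₁ at₂)

Lopsided : ℚ → Tree → Set
Lopsided h (leaf _)   = ⊥
Lopsided h (node a b) = (weight a ≡ h × weight b < h) ⊎ (weight b ≡ h × weight a < h)

lopsided? : ∀ h t → Dec (Lopsided h t)
lopsided? h (leaf _)   = no λ ()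
lopsided? h (node a b) = ((weight a ≟ h) ×-dec (weight b <? h)) ⊎-dec ((weight b ≟ h) ×-dec (weight a <? h))

lopsided-child : ∀ {h a b} → Lopsided h (node a b) →
  ∃[ x ] (weight (child x a b) ≡ h × weight (child (not x) a b) < h)
lopsided-child (inj₁ a-b) = false , a-b
lopsided-child (inj₂ b-a) = true , b-a

lopsided-weight : ∀ {h a b} → Positive (node a b) → Lopsided h (node a b) →
  h < weight (node a b) × weight (node a b) < h + h
lopsided-weight {a = a} {b} (pa , pb) (inj₁ (a≡h , b<h)) =
  subst (_< weight a + weight b) a≡h (p<p+q (weight a) (weight-pos pb)) ,
  +-mono-≤-< (≤-reflexive a≡h) b<h
lopsided-weight {a = a} {b} (pa , pb) (inj₂ (b≡h , a<h)) =
  subst₂ _<_ b≡h (+-comm (weight b) (weight a)) (p<p+q (weight b) (weight-pos pa)) ,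
  +-mono-<-≤ a<h (≤-reflexive b≡h)

lopsided-unique : ∀ {T} → SiblingProperty T → ∀ {h} q₁ q₂ {s₁ s₂} → q₁ ≢ q₂ →
  T at q₁ ≡ just s₁ → T at q₂ ≡ just s₂ → Lopsided h s₁ → Lopsided h s₂ → ⊥
lopsided-unique sib q₁ q₂ {node a₁ b₁} {node a₂ b₂} q₁≢q₂ e₁ e₂ l₁ l₂
  with lopsided-child l₁ | lopsided-child l₂ | sib q₁ q₂ q₁≢q₂ e₁ e₂
... | x₁ , h₁ , _   | x₂ , _ , lt₂ | inj₁ g₁≼g₂ =
  <⇒≱ lt₂ (subst (_≤ _) h₁ (≼-child {a₁} {b₁} {a₂} {b₂} g₁≼g₂ x₁ (not x₂)))
... | x₁ , _ , lt₁ | x₂ , h₂ , _   | inj₂ g₂≼g₁ =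
  <⇒≱ lt₁ (subst (_≤ _) h₂ (≼-child {a₂} {b₂} {a₁} {b₁} g₂≼g₁ x₂ (not x₁)))

lopsided⇒smaller-sibling : ∀ {T h} q {s} → T at q ≡ just s → Lopsided h s → HasSmallerSibling T h
lopsided⇒smaller-sibling q {node a b} e lop = q , a , b , e , lop

module AroundNode {T : Tree} (sib : SiblingProperty T)
  (p : Path) {c₁ c₂} (t-at : T at p ≡ just (node c₁ c₂)) (pos-t : Positive (node c₁ c₂))
  {w w′ w″ : ℚ} (t-weight : weight (node c₁ c₂) ≡ w)
  (i : Bool) (w′≡ : weight (child i c₁ c₂) ≡ w′) (w″≡ : weight (child (not i) c₁ c₂) ≡ w″)
  (w′≤w″ : w′ ≤ w″) where

  w≡w′+w″ : w ≡ w′ + w″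
  w≡w′+w″ = trans (sym t-weight) (trans (weight-node i c₁ c₂) (cong₂ _+_ w′≡ w″≡))

  w′<w : w′ < w
  w′<w = subst₂ _<_ w′≡ t-weight (child<node i pos-t)

  w″<w : w″ < w
  w″<w = subst₂ _<_ w″≡ t-weight (child<node (not i) pos-t)

  child-at-t : ∀ {a b} → T at p ≡ just (node a b) →
    ∀ x → (x ≡ i × weight (child x a b) ≡ w′) ⊎ (x ≡ not i × weight (child x a b) ≡ w″)
  child-at-t e x with at-functional T p e t-at | ≡⊎≡not x i
  ... | refl | inj₁ refl = inj₁ (refl , w′≡)
  ... | refl | inj₂ refl = inj₂ (refl , w″≡)

  sibling-dichotomy : ∀ g {a b} → g ≢ p → T at g ≡ just (node a b) →
    (∀ x → weight (child x a b) ≤ w′) ⊎ (∀ x → w″ ≤ weight (child x a b))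
  sibling-dichotomy g g≢p g-at with sib g p g≢p g-at t-at
  ... | inj₁ g≼t = inj₁ λ x → subst (_ ≤_) w′≡ (≼-child g≼t x i)
  ... | inj₂ t≼g = inj₂ λ x → subst (_≤ _) w″≡ (≼-child t≼g (not i) x)

  child-lower : ∀ g {a b} → T at g ≡ just (node a b) → w ≤ weight (node a b) →
    ∀ x → w′ ≤ weight (child x a b)
  child-lower g g-at w≤ x with g ≟ₚ p
  ... | yes refl with child-at-t g-at x
  ...   | inj₁ (_ , eq) = ≤-reflexive (sym eq)
  ...   | inj₂ (_ , eq) = subst (w′ ≤_) (sym eq) w′≤w″
  child-lower g {a} {b} g-at w≤ x | no g≢p with sibling-dichotomy g g≢p g-at
  ... | inj₁ ≤w′ = +-cancel-≤ (subst₂ _≤_ w≡w′+w″ (weight-node x a b) w≤) (≤-trans (≤w′ (not x)) w′≤w″)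
  ... | inj₂ w″≤ = ≤-trans w′≤w″ (w″≤ x)

  child-upper : ∀ g {a b} → T at g ≡ just (node a b) → weight (node a b) ≤ w →
    ∀ x → weight (child x a b) ≤ w″
  child-upper g g-at ≤w x with g ≟ₚ p
  ... | yes refl with child-at-t g-at x
  ...   | inj₁ (_ , eq) = subst (_≤ w″) (sym eq) w′≤w″
  ...   | inj₂ (_ , eq) = ≤-reflexive eq
  child-upper g {a} {b} g-at ≤w x | no g≢p with sibling-dichotomy g g≢p g-at
  ... | inj₁ ≤w′ = ≤-trans (≤w′ x) w′≤w″
  ... | inj₂ w″≤ =
    +-cancel-≤ (subst₂ _≤_ (weight-node x a b) (trans w≡w′+w″ (+-comm w′ w″)) ≤w) (≤-trans w′≤w″ (w″≤ (not x)))

  child-lower-strict : w′ < w″ → ∀ g {a b} → g ≢ p → T at g ≡ just (node a b) → w ≤ weight (node a b) →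
    ∀ x → w′ < weight (child x a b)
  child-lower-strict w′<w″ g g≢p g-at w≤ x with sibling-dichotomy g g≢p g-at
  ... | inj₂ w″≤ = <-≤-trans w′<w″ (w″≤ x)
  ... | inj₁ ≤w′ = ⊥-elim (<⇒≱ (≤-<-trans (+-mono-≤ (≤w′ false) (≤w′ true))
                                  (subst (w′ + w′ <_) (sym w≡w′+w″) (+-monoʳ-< w′ w′<w″))) w≤)

  child-upper-strict : w′ < w″ → ∀ g {a b} → g ≢ p → T at g ≡ just (node a b) → weight (node a b) ≤ w →
    ∀ x → weight (child x a b) < w″
  child-upper-strict w′<w″ g g≢p g-at ≤w x with sibling-dichotomy g g≢p g-at
  ... | inj₁ ≤w′ = ≤-<-trans (≤w′ x) w′<w″
  ... | inj₂ w″≤ = ⊥-elim (<⇒≱ (<-≤-trans (subst (_< w″ + w″) (sym w≡w′+w″) (+-monoˡ-< w″ w′<w″))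
                                  (+-mono-≤ (w″≤ false) (w″≤ true))) ≤w)

module AtLevel {T : Tree} (pos : Positive T) (sib : SiblingProperty T)
  (p : Path) {c₁ c₂} (t-at : T at p ≡ just (node c₁ c₂))
  {w w′ w″ : ℚ} (t-weight : weight (node c₁ c₂) ≡ w)
  (i : Bool) (w′≡ : weight (child i c₁ c₂) ≡ w′) (w″≡ : weight (child (not i) c₁ c₂) ≡ w″)
  (w′≤w″ : w′ ≤ w″)
  {ℓ : ℕ} (level-w : LevelWeight ℓ T w)
  (w-max : ∀ x → LevelWeight ℓ T x → InternalWeight T x → x ≤ w) where

  open AroundNode sib p t-at (Positive-at T p pos t-at) t-weight i w′≡ w″≡ w′≤w″

  level-internal-≤w : ∀ g {a b} → length g ≡ ℓ → T at g ≡ just (node a b) → weight (node a b) ≤ w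
  level-internal-≤w g {a} {b} l e = w-max _ (g , node a b , l , e , refl) (g , a , b , e , refl)

  shallow-≥w : ∀ q {u} → length q ℕ.< ℓ → T at q ≡ just u → w ≤ weight u
  shallow-≥w q lt e =
    let g , _ , l , e′ , weight≡w = level-w
    in subst (_≤ _) weight≡w (depth-antitone pos sib q g (subst (_ ℕ.<_) (sym l) lt) e e′)

  parent-shallower : ∀ g x → length (g ∷ʳ x) ≡ ℓ → length g ℕ.< ℓ
  parent-shallower g x l = ℕ.≤-reflexive (trans (sym (length-∷ʳ g x)) l)

  level-suc-≤w″ : ∀ q {s} → length q ≡ suc ℓ → T at q ≡ just s → weight s ≤ w″
  level-suc-≤w″ q l e with ∷ʳ-view q l
  ... | g , x , refl , lg with at-∷ʳ⁻ T g x e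
  ...   | a , b , g-at , refl = child-upper g g-at (level-internal-≤w g lg g-at) x

  deep-≤w″ : ∀ q {v} → ℓ ℕ.< length q → T at q ≡ just v → weight v ≤ w″
  deep-≤w″ q lt e with ancestor-≥ T q (suc ℓ) pos lt e
  ... | g , u , lg , g-at , v≤u = ≤-trans v≤u (level-suc-≤w″ g lg g-at)

  level-≥w′ : ∀ q {s} → length q ≡ ℓ → T at q ≡ just s → w′ ≤ weight s
  level-≥w′ q l e with reverseView q
  level-≥w′ q l refl | [] = subst (_≤ weight T) w′≡ (weight-at-≤ T (p ∷ʳ i) pos (at-∷ʳ T p i t-at))
  level-≥w′ q l e    | g ∶ _ ∶ʳ x with at-∷ʳ⁻ T g x e
  ... | a , b , g-at , refl = child-lower g g-at (shallow-≥w g (parent-shallower g x l) g-at) x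

  t-depth-≤ : length p ℕ.≤ ℓ
  t-depth-≤ = ℕ.≮⇒≥ λ ℓ<p → <⇒≱ w″<w (subst (_≤ w″) t-weight (deep-≤w″ p ℓ<p t-at))

  child-depth-≥ : ℓ ℕ.≤ suc (length p)
  child-depth-≥ = ℕ.≮⇒≥ λ lt → <⇒≱ w′<w
    (subst (w ≤_) w′≡ (shallow-≥w (p ∷ʳ i) (subst (ℕ._< ℓ) (sym (length-∷ʳ p i)) lt) (at-∷ʳ T p i t-at)))

  t-depth : length p ≡ ℓ ⊎ suc (length p) ≡ ℓ
  t-depth with ℕ.m≤n⇒m<n∨m≡n t-depth-≤
  ... | inj₂ p≡ℓ = inj₁ p≡ℓ
  ... | inj₁ p<ℓ = inj₂ (ℕ.≤-antisym p<ℓ child-depth-≥)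

  heavy-child-unique : w′ < w″ → length p ≡ ℓ → countW (suc ℓ) T w″ ≡ 1
  heavy-child-unique w′<w″ p-depth =
    level-count≡1 (λ s → weight s ≟ w″) (suc ℓ) T (p ∷ʳ not i)
      (trans (length-∷ʳ p (not i)) (cong suc p-depth)) (at-∷ʳ T p (not i) t-at) w″≡ only-heavy-child
    where
    only-heavy-child : ∀ q {s} → length q ≡ suc ℓ → T at q ≡ just s → weight s ≡ w″ → q ≡ p ∷ʳ not i
    only-heavy-child q l e s≡w″ with ∷ʳ-view q l
    ... | g , x , refl , lg with at-∷ʳ⁻ T g x e
    ...   | a , b , g-at , refl with g ≟ₚ p
    ...     | no g≢p = ⊥-elim (<-irrefl s≡w″ (child-upper-strict w′<w″ g g≢p g-at (level-internal-≤w g lg g-at) x))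
    ...     | yes refl with child-at-t g-at x
    ...       | inj₁ (_ , s≡w′) = ⊥-elim (<-irrefl (trans (sym s≡w′) s≡w″) w′<w″)
    ...       | inj₂ (refl , _) = refl

  light-child-unique : w′ < w″ → suc (length p) ≡ ℓ → countW ℓ T w′ ≡ 1
  light-child-unique w′<w″ p-depth =
    level-count≡1 (λ s → weight s ≟ w′) ℓ T (p ∷ʳ i)
      (trans (length-∷ʳ p i) p-depth) (at-∷ʳ T p i t-at) w′≡ only-light-child
    where
    only-light-child : ∀ q {s} → length q ≡ ℓ → T at q ≡ just s → weight s ≡ w′ → q ≡ p ∷ʳ i
    only-light-child q l e s≡w′ with reverseView q
    ... | [] with trans p-depth (sym l)
    ...   | ()
    only-light-child q l e s≡w′ | g ∶ _ ∶ʳ x with at-∷ʳ⁻ T g x e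
    ... | a , b , g-at , refl with g ≟ₚ p
    ...   | no g≢p = ⊥-elim (<-irrefl (sym s≡w′)
                       (child-lower-strict w′<w″ g g≢p g-at (shallow-≥w g (parent-shallower g x l) g-at) x))
    ...   | yes refl with child-at-t g-at x
    ...     | inj₁ (refl , _) = refl
    ...     | inj₂ (_ , s≡w″) = ⊥-elim (<-irrefl (trans (sym s≡w′) s≡w″) w′<w″)

  module Balanced (w′≡w″ : w′ ≡ w″) where

    w≡w′+w′ : w ≡ w′ + w′
    w≡w′+w′ = trans w≡w′+w″ (cong (w′ +_) (sym w′≡w″))

    ½w≡w′ : ½ * w ≡ w′
    ½w≡w′ = trans (cong (½ *_) w≡w′+w′) (½*[p+p]≡p w′)

    lopsided-depth : ∀ q {s} → T at q ≡ just s → Lopsided w′ s → length q ≡ ℓ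
    lopsided-depth q {node a b} e lop with lopsided-weight (Positive-at T q pos e) lop | ℕ.<-cmp (length q) ℓ
    ... | _ , s<w′+w′ | tri< q<ℓ _ _ = ⊥-elim (<⇒≱ s<w′+w′ (subst (_≤ _) w≡w′+w′ (shallow-≥w q q<ℓ e)))
    ... | _ | tri≈ _ q≡ℓ _ = q≡ℓ
    ... | w′<s , _ | tri> _ _ ℓ<q = ⊥-elim (<⇒≱ w′<s (subst (_ ≤_) (sym w′≡w″) (deep-≤w″ q ℓ<q e)))

    weighs-w′? : (s : Tree) → Dec (weight s ≡ w′)
    weighs-w′? s = weight s ≟ w′

    heavy-internal? : (s : Tree) → Dec (Internal s × weight s ≡ w)
    heavy-internal? s = internal? s ×-dec (weight s ≟ w)

    ChildrenTally : Tree → Set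
    ChildrenTally s =
      count weighs-w′? (children s) ≡ 2 *ℕ count heavy-internal? [ s ] +ℕ count (lopsided? w′) [ s ]

    node-tally : ∀ a b {ca cb ci cl : ℕ} → count weighs-w′? [ a ] ≡ ca → count weighs-w′? [ b ] ≡ cb →
      count heavy-internal? [ node a b ] ≡ ci → count (lopsided? w′) [ node a b ] ≡ cl → ca +ℕ cb ≡ 2 *ℕ ci +ℕ cl →
      ChildrenTally (node a b)
    node-tally a b {ca} {cb} {ci} {cl} ea eb ei el sums = begin
      count weighs-w′? (a ∷ b ∷ [])                     ≡⟨ count-∷ weighs-w′? a [ b ] ⟩
      count weighs-w′? [ a ] +ℕ count weighs-w′? [ b ]  ≡⟨ cong₂ _+ℕ_ ea eb ⟩
      ca +ℕ cb                                          ≡⟨ sums ⟩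
      2 *ℕ ci +ℕ cl                                     ≡⟨ sym (cong₂ (λ ci cl → 2 *ℕ ci +ℕ cl) ei el) ⟩
      2 *ℕ count heavy-internal? [ node a b ] +ℕ count (lopsided? w′) [ node a b ] ∎
      where open ≡-Reasoning

    heavy-node-tally : ∀ g {a b} → T at g ≡ just (node a b) → weight (node a b) ≡ w → ChildrenTally (node a b)
    heavy-node-tally g {a} {b} g-at s≡w =
      node-tally a b (count-yes weighs-w′? a (both false)) (count-yes weighs-w′? b (both true))
        (count-yes heavy-internal? (node a b) (internal a b , s≡w)) (count-no (lopsided? w′) (node a b) even) refl
      where
      both : ∀ x → weight (child x a b) ≡ w′
      both x = ≤-antisym (subst (_ ≤_) (sym w′≡w″) (child-upper g g-at (≤-reflexive s≡w) x))
                         (child-lower g g-at (≤-reflexive (sym s≡w)) x)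
      even : ¬ Lopsided w′ (node a b)
      even (inj₁ (_ , b<w′)) = <-irrefl (both true) b<w′
      even (inj₂ (_ , a<w′)) = <-irrefl (both false) a<w′

    light-node-tally : ∀ a b → count heavy-internal? [ node a b ] ≡ 0 → weight a + weight b < w′ + w′ →
      Dec (weight a ≡ w′) → Dec (weight b ≡ w′) → ChildrenTally (node a b)
    light-node-tally a b _ s< (yes a≡w′) (yes b≡w′) = ⊥-elim (<-irrefl (cong₂ _+_ a≡w′ b≡w′) s<)
    light-node-tally a b not-heavy s< (yes a≡w′) (no b≢w′) =
      node-tally a b (count-yes weighs-w′? a a≡w′) (count-no weighs-w′? b b≢w′) not-heavy
        (count-yes (lopsided? w′) (node a b) (inj₁ (a≡w′ , b<w′))) refl
      where
      b<w′ : weight b < w′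
      b<w′ = ≰⇒> λ w′≤b → <⇒≱ s< (+-mono-≤ (≤-reflexive (sym a≡w′)) w′≤b)
    light-node-tally a b not-heavy s< (no a≢w′) (yes b≡w′) =
      node-tally a b (count-no weighs-w′? a a≢w′) (count-yes weighs-w′? b b≡w′) not-heavy
        (count-yes (lopsided? w′) (node a b) (inj₂ (b≡w′ , a<w′))) refl
      where
      a<w′ : weight a < w′
      a<w′ = ≰⇒> λ w′≤a → <⇒≱ s< (+-mono-≤ w′≤a (≤-reflexive (sym b≡w′)))
    light-node-tally a b not-heavy s< (no a≢w′) (no b≢w′) =
      node-tally a b (count-no weighs-w′? a a≢w′) (count-no weighs-w′? b b≢w′) not-heavy
        (count-no (lopsided? w′) (node a b) uneven) refl
      where
      uneven : ¬ Lopsided w′ (node a b)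
      uneven (inj₁ (a≡w′ , _)) = a≢w′ a≡w′
      uneven (inj₂ (b≡w′ , _)) = b≢w′ b≡w′

    internal-node-tally : ∀ g {a b} → length g ≡ ℓ → T at g ≡ just (node a b) → Dec (weight (node a b) ≡ w) →
      ChildrenTally (node a b)
    internal-node-tally g _ g-at (yes s≡w) = heavy-node-tally g g-at s≡w
    internal-node-tally g {a} {b} lg g-at (no s≢w) =
      light-node-tally a b (count-no heavy-internal? (node a b) (s≢w ∘ proj₂))
        (subst (_ <_) w≡w′+w′ (≤∧≢⇒< (level-internal-≤w g lg g-at) s≢w)) (weight a ≟ w′) (weight b ≟ w′)

    level-node-tally : ∀ {s} → s ∈ level ℓ T → ChildrenTally s
    level-node-tally {leaf _}   _  = refl
    level-node-tally {node a b} s∈ =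
      let g , lg , g-at = ∈-level⁻ ℓ T s∈ in internal-node-tally g lg g-at (weight (node a b) ≟ w)

    next-level-count : countW (suc ℓ) T w′ ≡ 2 *ℕ countInternalW ℓ T w +ℕ count (lopsided? w′) (level ℓ T)
    next-level-count = trans (cong (count weighs-w′?) (level-suc ℓ T))
      (count-concatMap weighs-w′? heavy-internal? (lopsided? w′) children 2 (All.tabulate level-node-tally))

    smaller-sibling-cases :
      (HasSmallerSibling T w′ × count (lopsided? w′) (level ℓ T) ≡ 1)
      ⊎ (¬ HasSmallerSibling T w′ × count (lopsided? w′) (level ℓ T) ≡ 0)
    smaller-sibling-cases = ≤1-cases
      (count-≤1 (lopsided? w′) (level-allPairs ℓ T λ q₁ q₂ q₁≢q₂ _ _ → lopsided-unique sib q₁ q₂ q₁≢q₂))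
      (λ (q , a , b , e , lop) → count-≥1 (lopsided? w′) (∈-level⁺ ℓ T q (lopsided-depth q e lop) e) lop)
      (λ some → let s , s∈ , lop = find (count-≥1⁻ (lopsided? w′) some)
                    q , _ , e    = ∈-level⁻ ℓ T s∈
                in lopsided⇒smaller-sibling q e lop)

    balanced-case : ∃[ m ] ∃[ δ ] (countInternalW ℓ T w ≡ m ×
      countW (suc ℓ) T (½ * w) ≡ 2 *ℕ m +ℕ δ ×
      ((HasSmallerSibling T (½ * w) × δ ≡ 1) ⊎ (¬ HasSmallerSibling T (½ * w) × δ ≡ 0)))
    balanced-case rewrite ½w≡w′ = _ , _ , refl , next-level-count , smaller-sibling-cases

  level-cases :
    (w′ < w″ × length p ≡ ℓ × countW (suc ℓ) T w″ ≡ 1)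
    ⊎ ((w′ < w″ × suc (length p) ≡ ℓ × countW ℓ T w′ ≡ 1)
    ⊎ (w′ ≡ w″ × w′ ≡ ½ * w ×
       ∃[ m ] ∃[ δ ] (countInternalW ℓ T w ≡ m ×
         countW (suc ℓ) T (½ * w) ≡ 2 *ℕ m +ℕ δ ×
         ((HasSmallerSibling T (½ * w) × δ ≡ 1) ⊎ (¬ HasSmallerSibling T (½ * w) × δ ≡ 0)))))
  level-cases with <-cmp w′ w″
  ... | tri> _ _ w″<w′ = ⊥-elim (<⇒≱ w″<w′ w′≤w″)
  ... | tri≈ _ w′≡w″ _ = inj₂ (inj₂ (w′≡w″ , sym ½w≡w′ , balanced-case))
    where open Balanced w′≡w″
  ... | tri< w′<w″ _ _ with t-depth
  ...   | inj₁ p-depth = inj₁ (w′<w″ , p-depth , heavy-child-unique w′<w″ p-depth)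
  ...   | inj₂ p-depth = inj₂ (inj₁ (w′<w″ , p-depth , light-child-unique w′<w″ p-depth))

orientation : ∀ {w′ w″} c₁ c₂ → (w′ ≡ weight c₁ × w″ ≡ weight c₂) ⊎ (w′ ≡ weight c₂ × w″ ≡ weight c₁) →
  ∃[ i ] (weight (child i c₁ c₂) ≡ w′ × weight (child (not i) c₁ c₂) ≡ w″)
orientation c₁ c₂ (inj₁ (w′≡ , w″≡)) = false , sym w′≡ , sym w″≡
orientation c₁ c₂ (inj₂ (w′≡ , w″≡)) = true  , sym w′≡ , sym w″≡

lemma8 : (ws : List ℚ) → All (λ x → 0ℚ < x) ws →
    (T : Tree) → IsHuffmanTree ws T →
    (ℓ : ℕ) (w : ℚ) →
    LevelWeight ℓ T w → InternalWeight T w →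
    (∀ x → LevelWeight ℓ T x → InternalWeight T x → x ≤ w) →
    (p : Path) (c₁ c₂ : Tree) → T at p ≡ just (node c₁ c₂) → weight (node c₁ c₂) ≡ w →
    (w′ w″ : ℚ) →
    ((w′ ≡ weight c₁ × w″ ≡ weight c₂) ⊎ (w′ ≡ weight c₂ × w″ ≡ weight c₁)) →
    w′ ≤ w″ →
    All (λ s → w′ ≤ weight s) (level ℓ T) ×
    All (λ s → weight s ≤ w″) (level (suc ℓ) T) ×
    ((w′ < w″ × length p ≡ ℓ × countW (suc ℓ) T w″ ≡ 1)
     ⊎ ((w′ < w″ × suc (length p) ≡ ℓ × countW ℓ T w′ ≡ 1)
     ⊎ (w′ ≡ w″ × w′ ≡ ½ * w ×
        ∃[ m ] ∃[ δ ] (countInternalW ℓ T w ≡ m ×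
          countW (suc ℓ) T (½ * w) ≡ 2 *ℕ m +ℕ δ ×
          ((HasSmallerSibling T (½ * w) × δ ≡ 1)
           ⊎ (¬ HasSmallerSibling T (½ * w) × δ ≡ 0))))))
lemma8 ws pos T huffman ℓ w level-w _ w-max p c₁ c₂ t-at t-weight w′ w″ t-children w′≤w″
  with huffman-sibling pos huffman | orientation c₁ c₂ t-children
... | pos-T , sib | i , w′≡ , w″≡ =
  level-All ℓ T level-≥w′ , level-All (suc ℓ) T level-suc-≤w″ , level-cases
  where open AtLevel pos-T sib p t-at t-weight i w′≡ w″≡ w′≤w″ level-w w-max
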